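{- Let $t<k$ be positive integers, $i\in\{1,\dots,k\}$ and $e\ge0$ an integer. If both a $(\bar{1},t)$-LA$(N_1;k,(v_1,\dots,v_k))$ and a $(\bar{1},t-1)$-LA$(N_2;k-1,(v_1,\dots,v_{i-1},v_{i+1},\dots,v_k))$ exist, then a $(\bar{1},t)$-LA$(N_1+eN_2;k,(v_1,\dots,v_{i-1},v_i+e,v_{i+1},\dots,v_k))$ exists.
   Context: For positive integers $N,k,t$ and $v_1,\dots,v_k$, consider $N\times k$ arrays $A=(a_{rj})$ whose $j$-th column has entries from a set $V_j$ with $|V_j|=v_j$. A $t$-way interaction is $T=\{(j,\sigma_j):j\in I\}$ with $I\subseteq\{1,\dots,k\}$, $|I|=t$, $\sigma_j\in V_j$; $\rho(A,T)$ is the set of rows $r$ with $a_{rj}=\sigma_j$ for all $j\in I$, and $\rho(A,\mathcal T)=\bigcup_{T\in\mathcal T}\rho(A,T)$. $A$ is a $(\bar1,t)$-LA$(N;k,(v_1,\dots,v_k))$ if for all sets $\mathcal T_1,\mathcal T_2$ of $t$-way interactions with $|\mathcal T_1|,|\mathcal T_2|\le 1$: $\rho(A,\mathcal T_1)=\rho(A,\mathcal T_2)\iff\mathcal T_1=\mathcal T_2$ (equivalently: every $t$-way interaction occurs in some row and distinct interactions have distinct $\rho$). -}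

module Defs where

open import Data.Nat using (ℕ; zero; suc; _+_)
open import Data.Fin using (Fin)
open import Data.Vec using (Vec; []; _∷_)
open import Data.Maybe using (Maybe; just; nothing)
open import Data.Product using (Σ; _×_; _,_)
open import Data.Unit using (⊤)
open import Data.Empty using (⊥)
open import Relation.Binary.PropositionalEquality using (_≡_)

Row : ∀ {k} → Vec ℕ k → Set
Row []       = ⊤
Row (n ∷ vs) = Fin n × Row vs

Array : ℕ → ∀ {k} → Vec ℕ k → Set
Array N v = Fin N → Row v

-- A partial assignment: for each column j, either not involved (nothing)
-- or a value σ_j ∈ V_j.  An interaction {(j,σ_j) : j ∈ I} corresponds
-- exactly to the partial assignment defined on I.
Assign : ∀ {k} → Vec ℕ k → Set
Assign []       = ⊤
Assign (n ∷ vs) = Maybe (Fin n) × Assign vs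

strength : ∀ {k} {v : Vec ℕ k} → Assign v → ℕ
strength {v = []}    _              = 0
strength {v = _ ∷ _} (nothing , as) = strength as
strength {v = _ ∷ _} (just _  , as) = suc (strength as)

Interaction : ℕ → ∀ {k} → Vec ℕ k → Set
Interaction t v = Σ (Assign v) (λ T → strength T ≡ t)

Covers : ∀ {k} {v : Vec ℕ k} → Row v → Assign v → Set
Covers {v = []}    _        _              = ⊤
Covers {v = _ ∷ _} (x , xs) (nothing , as) = Covers xs as
Covers {v = _ ∷ _} (x , xs) (just σ  , as) = (x ≡ σ) × Covers xs as

-- ρ(A, 𝒯) for a set 𝒯 of at most one t-way interaction, represented as
-- Maybe (Interaction t v): nothing = ∅, just T = {T}.  As a predicate on rows.
ρ : ∀ {N t k} {v : Vec ℕ k} → Array N v → Maybe (Interaction t v) → Fin N → Set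
ρ A nothing        r = ⊥
ρ A (just (T , _)) r = Covers (A r) T

SameRows : ∀ {N} → (Fin N → Set) → (Fin N → Set) → Set
SameRows P Q = ∀ r → (P r → Q r) × (Q r → P r)

IsLA : ∀ {N} (t : ℕ) {k} {v : Vec ℕ k} → Array N v → Set
IsLA t {v = v} A =
  ∀ (𝒯₁ 𝒯₂ : Maybe (Interaction t v)) →
    (SameRows (ρ A 𝒯₁) (ρ A 𝒯₂) → 𝒯₁ ≡ 𝒯₂) × (𝒯₁ ≡ 𝒯₂ → SameRows (ρ A 𝒯₁) (ρ A 𝒯₂))

LA : ℕ → ℕ → ∀ {k} → Vec ℕ k → Set
LA N t v = Σ (Array N v) (IsLA t)

-- Keep the rows of the first array, reading their column-i symbols as the
-- old symbols of the enlarged alphabet, and for each of the e new symbols s add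
-- a copy of the second array with s inserted in column i.  An interaction whose
-- column-i entry is absent or old is an interaction of the first array and is
-- located by its rows alone, since they never carry a new symbol; one with a
-- new symbol s is s together with a (t-1)-way interaction of the other columns,
-- located by the copy belonging to s.
module Submission where

open import Defs
open import Data.Nat using (ℕ; suc; _+_; _*_; _∸_; _≤_; _<_)
open import Data.Fin using (Fin; zero; suc; _↑ˡ_; _↑ʳ_; splitAt)
open import Data.Vec using (Vec; removeAt; updateAt; []; _∷_; lookup)
open import Data.Vec.Relation.Unary.All using (All)

open import Data.Nat.Properties using (+-suc; ≡-irrelevant)
open import Data.Fin.Properties
  using (_≟_; any?; ↑ˡ-injective; ↑ʳ-injective; splitAt-↑ˡ; splitAt-↑ʳ; splitAt⁻¹-↑ˡ; splitAt⁻¹-↑ʳ; +↔⊎; *↔×)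
open import Data.Vec.Properties using (lookup∘updateAt)
open import Data.Maybe using (Maybe; just; nothing)
import Data.Maybe as Maybe
open import Data.Product using (∃; _×_; _,_; proj₁; proj₂; uncurry)
open import Data.Sum using (_⊎_; inj₁; inj₂)
open import Data.Sum.Function.Propositional using (_⊎-↔_)
open import Data.Unit using (⊤; tt)
open import Data.Empty using (⊥-elim)
open import Function using (_∘_; _⇔_; _↔_; mk⇔; Equivalence; Inverse)
open import Function.Properties.Inverse using (↔-refl; ↔-trans)
open import Relation.Nullary using (Dec; yes; no; ¬_)
open import Relation.Nullary.Decidable using (_×-dec_)
open import Relation.Binary.PropositionalEquality

open Equivalence using (to; from)

strength₁ : ∀ {n} → Maybe (Fin n) → ℕ
strength₁ nothing  = 0
strength₁ (just _) = 1

Covers₁ : ∀ {n} → Fin n → Maybe (Fin n) → Set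
Covers₁ x nothing  = ⊤
Covers₁ x (just σ) = x ≡ σ

covers? : ∀ {k} {v : Vec ℕ k} (r : Row v) (a : Assign v) → Dec (Covers r a)
covers? {v = []}    _        _              = yes tt
covers? {v = _ ∷ _} (x , xs) (nothing , as) = covers? xs as
covers? {v = _ ∷ _} (x , xs) (just σ , as)  = (x ≟ σ) ×-dec covers? xs as

Indistinguishable : ∀ {I : Set} {k} {v : Vec ℕ k} → (I → Row v) → Assign v → Assign v → Set
Indistinguishable A a b = ∀ r → Covers (A r) a ⇔ Covers (A r) b

record Locating {I : Set} (t : ℕ) {k} {v : Vec ℕ k} (A : I → Row v) : Set where
  field
    covered   : ∀ a → strength a ≡ t → ∃ λ r → Covers (A r) a
    separated : ∀ a b → strength a ≡ t → strength b ≡ t → Indistinguishable A a b → a ≡ b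

IsLA⇒Locating : ∀ {N t k} {v : Vec ℕ k} (A : Array N v) → IsLA t A → Locating t A
IsLA⇒Locating {t = t} A la = record { covered = covered ; separated = separated }
  where
  covered : ∀ a → strength a ≡ t → ∃ λ r → Covers (A r) a
  covered a p with any? (λ r → covers? (A r) a)
  ... | yes found = found
  ... | no ¬found with proj₁ (la (just (a , p)) nothing) (λ r → (λ c → ¬found (r , c)) , λ ())
  ... | ()

  separated : ∀ a b → strength a ≡ t → strength b ≡ t → Indistinguishable A a b → a ≡ b
  separated a b p q a≈b with proj₁ (la (just (a , p)) (just (b , q))) (λ r → to (a≈b r) , from (a≈b r))
  ... | refl = refl

Locating⇒IsLA : ∀ {N t k} {v : Vec ℕ k} (A : Array N v) → Locating t A → IsLA t A
Locating⇒IsLA A L 𝒯₁ 𝒯₂ = locates 𝒯₁ 𝒯₂ , λ { refl r → (λ c → c) , (λ c → c) }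
  where
  open Locating L
  locates : ∀ 𝒯₁ 𝒯₂ → SameRows (ρ A 𝒯₁) (ρ A 𝒯₂) → 𝒯₁ ≡ 𝒯₂
  locates nothing        nothing        _  = refl
  locates nothing        (just (b , q)) same =
    let (r , c) = covered b q in ⊥-elim (proj₂ (same r) c)
  locates (just (a , p)) nothing        same =
    let (r , c) = covered a p in ⊥-elim (proj₁ (same r) c)
  locates (just (a , p)) (just (b , q)) same
    with separated a b p q (λ r → mk⇔ (proj₁ (same r)) (proj₂ (same r)))
  ... | refl = cong (λ p → just (a , p)) (≡-irrelevant p q)

Locating-reindex : ∀ {I J : Set} {t k} {v : Vec ℕ k} {A : J → Row v} (f : I ↔ J) →
                   Locating t A → Locating t (A ∘ Inverse.to f)
Locating-reindex {A = A} f L = record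
  { covered   = λ a p → let (r , c) = covered a p in f⁻¹ r , subst (λ r → Covers (A r) a) (sym (f∘f⁻¹ r)) c
  ; separated = λ a b p q a≈b → separated a b p q (λ r → subst (λ r → Covers (A r) a ⇔ Covers (A r) b) (f∘f⁻¹ r) (a≈b (f⁻¹ r)))
  }
  where
  open Locating L
  open Inverse f using () renaming (from to f⁻¹; strictlyInverseˡ to f∘f⁻¹)

record ColumnSplit {k} (w : Vec ℕ (suc k)) (n : ℕ) (u : Vec ℕ k) : Set where
  field
    joinRow                : Fin n → Row u → Row w
    splitRow               : Row w → Fin n × Row u
    joinRow-splitRow       : ∀ r → uncurry joinRow (splitRow r) ≡ r
    joinAssign             : Maybe (Fin n) → Assign u → Assign w
    splitAssign            : Assign w → Maybe (Fin n) × Assign u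
    joinAssign-splitAssign : ∀ T → uncurry joinAssign (splitAssign T) ≡ T
    splitAssign-joinAssign : ∀ m a → splitAssign (joinAssign m a) ≡ (m , a)
    strength-joinAssign    : ∀ m a → strength (joinAssign m a) ≡ strength₁ m + strength a
    covers-join            : ∀ x r m a → Covers (joinRow x r) (joinAssign m a) ⇔ (Covers₁ x m × Covers r a)

  joinAssign-injective : ∀ {m m′ a a′} → joinAssign m a ≡ joinAssign m′ a′ → (m , a) ≡ (m′ , a′)
  joinAssign-injective {m} {m′} {a} {a′} eq = begin
    (m , a)                        ≡⟨ splitAssign-joinAssign m a ⟨
    splitAssign (joinAssign m a)   ≡⟨ cong splitAssign eq ⟩
    splitAssign (joinAssign m′ a′) ≡⟨ splitAssign-joinAssign m′ a′ ⟩
    (m′ , a′)                      ∎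
    where open ≡-Reasoning

splitHead : ∀ {k} n (u : Vec ℕ k) → ColumnSplit (n ∷ u) n u
splitHead n u = record
  { joinRow                = _,_
  ; splitRow               = λ r → r
  ; joinRow-splitRow       = λ _ → refl
  ; joinAssign             = _,_
  ; splitAssign            = λ T → T
  ; joinAssign-splitAssign = λ _ → refl
  ; splitAssign-joinAssign = λ _ _ → refl
  ; strength-joinAssign    = λ { nothing _ → refl ; (just _) _ → refl }
  ; covers-join            = λ { x r nothing a → mk⇔ (tt ,_) proj₂ ; x r (just _) a → mk⇔ (λ c → c) (λ c → c) }
  }

splitTail : ∀ {k} x {w : Vec ℕ (suc k)} {n u} → ColumnSplit w n u → ColumnSplit (x ∷ w) n (x ∷ u)
splitTail x {u = u} S = record
  { joinRow                = λ y (z , r) → z , joinRow y r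
  ; splitRow               = λ (z , r) → let (y , r′) = splitRow r in y , (z , r′)
  ; joinRow-splitRow       = λ (z , r) → cong (z ,_) (joinRow-splitRow r)
  ; joinAssign             = λ m (σ , a) → σ , joinAssign m a
  ; splitAssign            = λ (σ , T) → let (m , a) = splitAssign T in m , (σ , a)
  ; joinAssign-splitAssign = λ (σ , T) → cong (σ ,_) (joinAssign-splitAssign T)
  ; splitAssign-joinAssign = λ m (σ , a) → cong (λ (m , a) → m , (σ , a)) (splitAssign-joinAssign m a)
  ; strength-joinAssign    = strength-join
  ; covers-join            = covers
  }
  where
  open ColumnSplit S
  strength-join : ∀ m (a : Assign (x ∷ u)) →
    strength {v = x ∷ _} (proj₁ a , joinAssign m (proj₂ a)) ≡ strength₁ m + strength a
  strength-join m (nothing , a) = strength-joinAssign m a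
  strength-join m (just _ , a)  = trans (cong suc (strength-joinAssign m a)) (sym (+-suc (strength₁ m) _))
  covers : ∀ y (r : Row (x ∷ u)) m (a : Assign (x ∷ u)) →
    Covers {v = x ∷ _} (proj₁ r , joinRow y (proj₂ r)) (proj₁ a , joinAssign m (proj₂ a)) ⇔ (Covers₁ y m × Covers r a)
  covers y (z , r) m (nothing , a) = covers-join y r m a
  covers y (z , r) m (just σ , a)  = mk⇔
    (λ (z≡σ , c) → let (c₁ , c′) = to (covers-join y r m a) c in c₁ , (z≡σ , c′))
    (λ (c₁ , (z≡σ , c′)) → z≡σ , from (covers-join y r m a) (c₁ , c′))

columnSplit : ∀ {k} (v : Vec ℕ (suc k)) i → ColumnSplit v (lookup v i) (removeAt v i)
columnSplit (x ∷ xs)             zero    = splitHead x xs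
columnSplit {suc _} (x ∷ y ∷ ys) (suc i) = splitTail x (columnSplit (y ∷ ys) i)

removeAt∘updateAt : ∀ {A : Set} {k} (v : Vec A (suc k)) i (f : A → A) → removeAt (updateAt v i f) i ≡ removeAt v i
removeAt∘updateAt               (x ∷ v)     zero          f = refl
removeAt∘updateAt {k = suc _} (x ∷ y ∷ v) (suc zero)    f = refl
removeAt∘updateAt {k = suc _} (x ∷ y ∷ v) (suc (suc i)) f = cong (x ∷_) (removeAt∘updateAt (y ∷ v) (suc i) f)

columnSplit-updateAt : ∀ {k} (v : Vec ℕ (suc k)) i (f : ℕ → ℕ) →
                       ColumnSplit (updateAt v i f) (f (lookup v i)) (removeAt v i)
columnSplit-updateAt v i f =
  subst₂ (ColumnSplit (updateAt v i f)) (lookup∘updateAt i v) (removeAt∘updateAt v i f)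
         (columnSplit (updateAt v i f) i)

module Extension {k} {v w : Vec ℕ (suc k)} {n e} {u : Vec ℕ k} {I₁ I₂ : Set} {t : ℕ}
  (V : ColumnSplit v n u) (W : ColumnSplit w (n + e) u)
  (A₁ : I₁ → Row v) (A₂ : I₂ → Row u) (L₁ : Locating t A₁) (L₂ : Locating (t ∸ 1) A₂) where

  private
    module V = ColumnSplit V
    module W = ColumnSplit W
    module L₁ = Locating L₁
    module L₂ = Locating L₂

  old : Fin n → Fin (n + e)
  old x = x ↑ˡ e

  new : Fin e → Fin (n + e)
  new s = n ↑ʳ s

  extend : I₁ ⊎ (Fin e × I₂) → Row w
  extend (inj₁ r)       = let (x , r′) = V.splitRow (A₁ r) in W.joinRow (old x) r′
  extend (inj₂ (s , r)) = W.joinRow (new s) (A₂ r)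

  data Kind : Assign w → Set where
    oldKind : ∀ m a → Kind (W.joinAssign (Maybe.map old m) a)
    newKind : ∀ s a → Kind (W.joinAssign (just (new s)) a)

  kind : ∀ T → Kind T
  kind T = subst Kind (W.joinAssign-splitAssign T) (kind′ (W.splitAssign T))
    where
    kind′ : ∀ ((m , a) : Maybe (Fin (n + e)) × Assign u) → Kind (W.joinAssign m a)
    kind′ (nothing , a) = oldKind nothing a
    kind′ (just y , a) with splitAt n y in eq
    ... | inj₁ x rewrite sym (splitAt⁻¹-↑ˡ eq) = oldKind (just x) a
    ... | inj₂ s rewrite sym (splitAt⁻¹-↑ʳ eq) = newKind s a

  old≢new : ∀ x s → old x ≢ new s
  old≢new x s eq with trans (sym (splitAt-↑ˡ n x e)) (trans (cong (splitAt n) eq) (splitAt-↑ʳ n e s))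
  ... | ()

  strength-old : ∀ m a → strength (W.joinAssign (Maybe.map old m) a) ≡ strength (V.joinAssign m a)
  strength-old nothing  a = trans (W.strength-joinAssign nothing a) (sym (V.strength-joinAssign nothing a))
  strength-old (just x) a = trans (W.strength-joinAssign (just (old x)) a) (sym (V.strength-joinAssign (just x) a))

  strength-new : ∀ s a → strength (W.joinAssign (just (new s)) a) ≡ t → strength a ≡ t ∸ 1
  strength-new s a p = cong (_∸ 1) (trans (sym (W.strength-joinAssign _ a)) p)

  covers₁-old : ∀ x m → Covers₁ (old x) (Maybe.map old m) ⇔ Covers₁ x m
  covers₁-old x nothing  = mk⇔ (λ _ → tt) (λ _ → tt)
  covers₁-old x (just y) = mk⇔ (↑ˡ-injective e x y) (cong old)

  covers-old : ∀ r m a → Covers (extend (inj₁ r)) (W.joinAssign (Maybe.map old m) a) ⇔ Covers (A₁ r) (V.joinAssign m a)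
  covers-old r m a = mk⇔
    (λ c → let (c₁ , c′) = to (W.covers-join _ _ _ a) c
           in subst (λ z → Covers z (V.joinAssign m a)) (V.joinRow-splitRow (A₁ r))
                    (from (V.covers-join _ _ m a) (to (covers₁-old _ m) c₁ , c′)))
    (λ c → let (c₁ , c′) = to (V.covers-join _ _ m a)
                               (subst (λ z → Covers z (V.joinAssign m a)) (sym (V.joinRow-splitRow (A₁ r))) c)
           in from (W.covers-join _ _ _ a) (from (covers₁-old _ m) c₁ , c′))

  ¬covers-new : ∀ r s a → ¬ Covers (extend (inj₁ r)) (W.joinAssign (just (new s)) a)
  ¬covers-new r s a c = old≢new _ s (proj₁ (to (W.covers-join _ _ _ a) c))

  covers-new : ∀ s r a → Covers (extend (inj₂ (s , r))) (W.joinAssign (just (new s)) a) ⇔ Covers (A₂ r) a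
  covers-new s r a = mk⇔ (proj₂ ∘ to (W.covers-join _ _ _ a)) (from (W.covers-join _ _ _ a) ∘ (refl ,_))

  covers-new⇒same : ∀ s′ s r a → Covers (extend (inj₂ (s′ , r))) (W.joinAssign (just (new s)) a) → s′ ≡ s
  covers-new⇒same s′ s r a c = ↑ʳ-injective n s′ s (proj₁ (to (W.covers-join _ _ _ a) c))

  restrict : ∀ {J : Set} {l} {x : Vec ℕ l} {T T′ a a′} (f : J → I₁ ⊎ (Fin e × I₂)) (B : J → Row x) →
             (∀ r → Covers (extend (f r)) T ⇔ Covers (B r) a) → (∀ r → Covers (extend (f r)) T′ ⇔ Covers (B r) a′) →
             Indistinguishable extend T T′ → Indistinguishable B a a′
  restrict f B eqv eqv′ T≈T′ r = mk⇔
    (to (eqv′ r) ∘ to (T≈T′ (f r)) ∘ from (eqv r))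
    (to (eqv r) ∘ from (T≈T′ (f r)) ∘ from (eqv′ r))

  covered-old : ∀ m a → strength (W.joinAssign (Maybe.map old m) a) ≡ t →
                ∃ λ r → Covers (extend (inj₁ r)) (W.joinAssign (Maybe.map old m) a)
  covered-old m a p =
    let (r , c) = L₁.covered (V.joinAssign m a) (trans (sym (strength-old m a)) p)
    in r , from (covers-old r m a) c

  covered-new : ∀ s a → strength (W.joinAssign (just (new s)) a) ≡ t →
                ∃ λ r → Covers (extend (inj₂ (s , r))) (W.joinAssign (just (new s)) a)
  covered-new s a p =
    let (r , c) = L₂.covered a (strength-new s a p)
    in r , from (covers-new s r a) c

  covered : ∀ {T} → Kind T → strength T ≡ t → ∃ λ r → Covers (extend r) T
  covered (oldKind m a) p = let (r , c) = covered-old m a p in inj₁ r , c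
  covered (newKind s a) p = let (r , c) = covered-new s a p in inj₂ (s , r) , c

  separated : ∀ {T T′} → Kind T → Kind T′ → strength T ≡ t → strength T′ ≡ t →
              Indistinguishable extend T T′ → T ≡ T′
  separated (oldKind m a) (oldKind m′ a′) p p′ T≈T′
    with V.joinAssign-injective
           (L₁.separated _ _ (trans (sym (strength-old m a)) p) (trans (sym (strength-old m′ a′)) p′)
                         (restrict inj₁ A₁ (λ r → covers-old r m a) (λ r → covers-old r m′ a′) T≈T′))
  ... | refl = refl
  separated (oldKind m a) (newKind s′ a′) p _ T≈T′ =
    let (r , c) = covered-old m a p in ⊥-elim (¬covers-new r s′ a′ (to (T≈T′ (inj₁ r)) c))
  separated (newKind s a) (oldKind m′ a′) _ p′ T≈T′ =
    let (r , c) = covered-old m′ a′ p′ in ⊥-elim (¬covers-new r s a (from (T≈T′ (inj₁ r)) c))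
  separated (newKind s a) (newKind s′ a′) p p′ T≈T′
    with covered-new s a p
  ... | r , c with covers-new⇒same s s′ r a′ (to (T≈T′ (inj₂ (s , r))) c)
  ... | refl = cong (W.joinAssign (just (new s)))
                 (L₂.separated a a′ (strength-new s a p) (strength-new s a′ p′)
                   (restrict (inj₂ ∘ (s ,_)) A₂ (λ r → covers-new s r a) (λ r → covers-new s r a′) T≈T′))

  locating : Locating t extend
  locating = record
    { covered   = λ T p → covered (kind T) p
    ; separated = λ T T′ p p′ → separated (kind T) (kind T′) p p′
    }

mainTheorem19 : (t k : ℕ) → 1 ≤ t → t < suc k →
    (v : Vec ℕ (suc k)) → All (1 ≤_) v →
    (i : Fin (suc k)) (e N₁ N₂ : ℕ) → 1 ≤ N₁ → 1 ≤ N₂ →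
    LA N₁ t v → LA N₂ (t ∸ 1) (removeAt v i) →
    LA (N₁ + e * N₂) t (updateAt v i (_+ e))
-- The construction needs none of the side conditions on t, v, N₁ and N₂.
mainTheorem19 t k _ _ v _ i e N₁ N₂ _ _ (A₁ , A₁-isLA) (A₂ , A₂-isLA) =
  extend ∘ Inverse.to rows , Locating⇒IsLA _ (Locating-reindex rows locating)
  where
  open Extension (columnSplit v i) (columnSplit-updateAt v i (_+ e)) A₁ A₂
                 (IsLA⇒Locating A₁ A₁-isLA) (IsLA⇒Locating A₂ A₂-isLA)
  rows : Fin (N₁ + e * N₂) ↔ (Fin N₁ ⊎ (Fin e × Fin N₂))
  rows = ↔-trans +↔⊎ (↔-refl ⊎-↔ *↔×)
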